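{- (2-cut with residual) Let $R_1,R_2\subseteq\Omega$ be such that $\overline{R_1}$ and $\overline{R_2}$ are disjoint. For all sequents $\Gamma_1,\Gamma_2$ and every formula $A$ of LMRL, if $\vdash\Gamma_1,R_1\{A\}$ and $\vdash\Gamma_2,R_2\{A\}$ are derivable in LMRL, then $\vdash\Gamma_1,\Gamma_2,(R_1\cap R_2)\{A\}$ is derivable in LMRL.
   Context: Fix a set $\Omega$ of roles (possibly infinite). A role set is a subset $R\subseteq\Omega$; $\overline{R}=\Omega\setminus R$; $R_1\uplus\cdots\uplus R_n=\Omega$ means the $R_i$ are pairwise disjoint with union $\Omega$. An ultrafilter on $\Omega$ is a family $\mathcal U$ of subsets of $\Omega$ with $\Omega\in\mathcal U$, closed upward and under binary intersection, and containing $R$ or $\overline R$ for every $R$. For an endomorphism $f$ of $\Omega$, $f^{ -1}(R)=\{r\mid f(r)\in R\}$. Formulas of LMRL, over first-order terms $t$ and variables $x$: $A,B::=a\mid\neg_f(A)\mid A\otimes_{\mathcal U}B\mid A\,\&_{\mathcal U}B\mid !_{\mathcal U}(A)\mid\forall_{\mathcal U}(\lambda x.A)$ ($a$ primitive, $f$ endomorphisms, $\mathcal U$ ultrafilters); $A[x:=t]$ is substitution. An i-formula is $R\{A\}$; a sequent is a finite multiset of i-formulas. $?(\Gamma)$ denotes a sequent every i-formula of which has the form $R\{!_{\mathcal U}(C)\}$ with $R\notin\mathcal U$. Rules of LMRL: (Id) $\vdash R_1\{a\},\ldots,R_n\{a\}$ whenever $R_1\uplus\cdots\uplus R_n=\Omega$;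 ($\neg$) from $\Gamma,f^{ -1}(R)\{A\}$ infer $\Gamma,R\{\neg_f(A)\}$; ($\&$-neg-l/r) if $R\notin\mathcal U$, from $\Gamma,R\{A\}$ (resp. $\Gamma,R\{B\}$) infer $\Gamma,R\{A\,\&_{\mathcal U}B\}$; ($\&$-pos) if $R\in\mathcal U$, from $\Gamma,R\{A\}$ and $\Gamma,R\{B\}$ infer $\Gamma,R\{A\,\&_{\mathcal U}B\}$; ($\otimes$-neg) if $R\notin\mathcal U$, from $\Gamma,R\{A\},R\{B\}$ infer $\Gamma,R\{A\otimes_{\mathcal U}B\}$; ($\otimes$-pos) if $R\in\mathcal U$, from $\Gamma_1,R\{A\}$ and $\Gamma_2,R\{B\}$ infer $\Gamma_1,\Gamma_2,R\{A\otimes_{\mathcal U}B\}$; ($!$-pos) if $R\in\mathcal U$, from $?(\Gamma),R\{A\}$ infer $?(\Gamma),R\{!_{\mathcal U}(A)\}$; ($!$-neg-weaken) if $R\notin\mathcal U$, from $\Gamma$ infer $\Gamma,R\{!_{\mathcal U}(A)\}$; ($!$-neg-derelict) if $R\notin\mathcal U$, from $\Gamma,R\{A\}$ infer $\Gamma,R\{!_{\mathcal U}(A)\}$; ($!$-neg-contract) if $R\notin\mathcal U$, from $\Gamma,R\{!_{\mathcal U}(A)\},R\{!_{\mathcal U}(A)\}$ infer $\Gamma,R\{!_{\mathcal U}(A)\}$; ($\forall$-neg) if $R\notin\mathcal U$, from $\Gamma,R\{A[x:=t]\}$ infer $\Gamma,R\{\forall_{\mathcal U}(\lambda x.A)\}$;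 ($\forall$-pos) if $R\in\mathcal U$ and $x$ not free in $\Gamma$, from $\Gamma,R\{A\}$ infer $\Gamma,R\{\forall_{\mathcal U}(\lambda x.A)\}$. -}

module Defs where

open import Level using (0ℓ)
open import Data.Nat using (ℕ; zero; suc)
open import Data.Vec using (Vec; []; _∷_)
open import Data.List using (List; []; _∷_; _++_; map)
open import Data.List.Relation.Unary.All using (All)
open import Data.List.Relation.Unary.Any using (Any)
open import Data.List.Relation.Unary.AllPairs using (AllPairs)
open import Data.List.Relation.Binary.Permutation.Propositional using (_↭_)
open import Data.Product using (_×_)
open import Data.Sum using (_⊎_)
open import Data.Unit using (⊤)
open import Relation.Nullary using (¬_)
open import Relation.Unary using (Pred; _⊆_; _∩_; ∁)

RoleSet : Set → Set₁
RoleSet Ω = Pred Ω 0ℓ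

record Ultrafilter (Ω : Set) : Set₁ where
  field
    mem   : Pred (RoleSet Ω) 0ℓ
    whole : mem (λ _ → ⊤)
    up    : ∀ {R S : RoleSet Ω} → R ⊆ S → mem R → mem S
    inter : ∀ {R S : RoleSet Ω} → mem R → mem S → mem (R ∩ S)
    ultra : ∀ (R : RoleSet Ω) → mem R ⊎ mem (∁ R)

open Ultrafilter public

preimage : {Ω : Set} → (Ω → Ω) → RoleSet Ω → RoleSet Ω
preimage f R = λ r → R (f r)

-- R₁ ⊎ ... ⊎ Rₙ = Ω : pairwise disjoint (at distinct positions) and covering.
Partition : {Ω : Set} → List (RoleSet Ω) → Set₁
Partition {Ω} Rs =
  AllPairs (λ R S → ∀ (r : Ω) → ¬ (R r × S r)) Rs × (∀ (r : Ω) → Any (λ R → R r) Rs)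

record Signature : Set₁ where
  field
    FunSym    : Set
    funArity  : FunSym → ℕ
    PredSym   : Set
    predArity : PredSym → ℕ

open Signature public

module _ (Sg : Signature) where

  data Term : Set where
    var : ℕ → Term
    fun : (g : FunSym Sg) → Vec Term (funArity Sg g) → Term

  mutual
    renT : (ℕ → ℕ) → Term → Term
    renT ρ (var x)    = var (ρ x)
    renT ρ (fun g ts) = fun g (renTs ρ ts)

    renTs : ∀ {k} → (ℕ → ℕ) → Vec Term k → Vec Term k
    renTs ρ []       = []
    renTs ρ (t ∷ ts) = renT ρ t ∷ renTs ρ ts

  mutual
    subT : (ℕ → Term) → Term → Term
    subT σ (var x)    = σ x
    subT σ (fun g ts) = fun g (subTs σ ts)

    subTs : ∀ {k} → (ℕ → Term) → Vec Term k → Vec Term k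
    subTs σ []       = []
    subTs σ (t ∷ ts) = subT σ t ∷ subTs σ ts

  -- LMRL formulas over roles Ω.  `all U A` is ∀_U(λx.A), binding de Bruijn
  -- variable 0 in A.

  data Formula (Ω : Set) : Set₁ where
    atom   : (P : PredSym Sg) → Vec Term (predArity Sg P) → Formula Ω
    neg    : (Ω → Ω) → Formula Ω → Formula Ω
    tensor : Ultrafilter Ω → Formula Ω → Formula Ω → Formula Ω
    with′  : Ultrafilter Ω → Formula Ω → Formula Ω → Formula Ω
    bang   : Ultrafilter Ω → Formula Ω → Formula Ω
    all    : Ultrafilter Ω → Formula Ω → Formula Ω

  liftR : (ℕ → ℕ) → ℕ → ℕ
  liftR ρ zero    = zero
  liftR ρ (suc x) = suc (ρ x)

  liftS : (ℕ → Term) → ℕ → Term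
  liftS σ zero    = var zero
  liftS σ (suc x) = renT suc (σ x)

  renF : {Ω : Set} → (ℕ → ℕ) → Formula Ω → Formula Ω
  renF ρ (atom P ts)    = atom P (renTs ρ ts)
  renF ρ (neg f A)      = neg f (renF ρ A)
  renF ρ (tensor U A B) = tensor U (renF ρ A) (renF ρ B)
  renF ρ (with′ U A B)  = with′ U (renF ρ A) (renF ρ B)
  renF ρ (bang U A)     = bang U (renF ρ A)
  renF ρ (all U A)      = all U (renF (liftR ρ) A)

  subF : {Ω : Set} → (ℕ → Term) → Formula Ω → Formula Ω
  subF σ (atom P ts)    = atom P (subTs σ ts)
  subF σ (neg f A)      = neg f (subF σ A)
  subF σ (tensor U A B) = tensor U (subF σ A) (subF σ B)
  subF σ (with′ U A B)  = with′ U (subF σ A) (subF σ B)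
  subF σ (bang U A)     = bang U (subF σ A)
  subF σ (all U A)      = all U (subF (liftS σ) A)

  single : Term → ℕ → Term
  single t zero    = t
  single t (suc x) = var x

  inst : {Ω : Set} → Formula Ω → Term → Formula Ω
  inst A t = subF (single t) A

  module _ (Ω : Set) where

    infix 6 _▹_
    data IFormula : Set₁ where
      _▹_ : RoleSet Ω → Formula Ω → IFormula

    shiftI : IFormula → IFormula
    shiftI (R ▹ A) = R ▹ renF suc A

    -- Sequents: finite multisets, represented by lists up to permutation
    -- (see the exchange rule below).
    Sequent : Set₁
    Sequent = List IFormula

    data IsWhyNot : IFormula → Set₁ where
      whyNot : ∀ {R : RoleSet Ω} {U : Ultrafilter Ω} {C : Formula Ω} →
               ¬ mem U R → IsWhyNot (R ▹ bang U C)

    infix 3 Derivable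
    data Derivable : Sequent → Set₁ where
      ax : ∀ (Rs : List (RoleSet Ω)) (P : PredSym Sg) (ts : Vec Term (predArity Sg P)) →
           Partition Rs →
           Derivable (map (λ R → R ▹ atom P ts) Rs)
      exch : ∀ {Γ Δ} → Γ ↭ Δ → Derivable Γ → Derivable Δ
      negR : ∀ {Γ R f A} →
             Derivable (preimage f R ▹ A ∷ Γ) → Derivable (R ▹ neg f A ∷ Γ)
      with-neg-l : ∀ {Γ R U A B} → ¬ mem U R →
             Derivable (R ▹ A ∷ Γ) → Derivable (R ▹ with′ U A B ∷ Γ)
      with-neg-r : ∀ {Γ R U A B} → ¬ mem U R →
             Derivable (R ▹ B ∷ Γ) → Derivable (R ▹ with′ U A B ∷ Γ)
      with-pos : ∀ {Γ R U A B} → mem U R →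
             Derivable (R ▹ A ∷ Γ) → Derivable (R ▹ B ∷ Γ) →
             Derivable (R ▹ with′ U A B ∷ Γ)
      tensor-neg : ∀ {Γ R U A B} → ¬ mem U R →
             Derivable (R ▹ A ∷ R ▹ B ∷ Γ) → Derivable (R ▹ tensor U A B ∷ Γ)
      tensor-pos : ∀ {Γ₁ Γ₂ R U A B} → mem U R →
             Derivable (R ▹ A ∷ Γ₁) → Derivable (R ▹ B ∷ Γ₂) →
             Derivable (R ▹ tensor U A B ∷ (Γ₁ ++ Γ₂))
      bang-pos : ∀ {Γ R U A} → mem U R → All IsWhyNot Γ →
             Derivable (R ▹ A ∷ Γ) → Derivable (R ▹ bang U A ∷ Γ)
      bang-weaken : ∀ {Γ R U A} → ¬ mem U R →
             Derivable Γ → Derivable (R ▹ bang U A ∷ Γ)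
      bang-derelict : ∀ {Γ R U A} → ¬ mem U R →
             Derivable (R ▹ A ∷ Γ) → Derivable (R ▹ bang U A ∷ Γ)
      bang-contract : ∀ {Γ R U A} → ¬ mem U R →
             Derivable (R ▹ bang U A ∷ R ▹ bang U A ∷ Γ) →
             Derivable (R ▹ bang U A ∷ Γ)
      all-neg : ∀ {Γ R U A} → ¬ mem U R → (t : Term) →
             Derivable (R ▹ inst A t ∷ Γ) → Derivable (R ▹ all U A ∷ Γ)
      all-pos : ∀ {Γ R U A} → mem U R →
             Derivable (R ▹ A ∷ map shiftI Γ) → Derivable (R ▹ all U A ∷ Γ)

{-# OPTIONS --safe #-}

-- Cut elimination, by induction on the shape of A (A with terms, roles and ultrafilters
-- erased; shapes are invariant under substitution, so the ∀ case may cut on an instance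
-- A[x:=t]) and, inside, on the two derivations. As R₁ ∪ R₂ = Ω, every ultrafilter contains
-- R₁ or R₂, so at least one of R₁{A}, R₂{A} is not of the form R{!_U(C)} with R ∉ U; such an
-- occurrence never lies in the context of a !-promotion. The cut is permuted upwards in that
-- derivation until its occurrence is principal, and then in the other one. At a principal
-- cut, R₁ ∩ R₂ ∈ U iff R₁ ∈ U and R₂ ∈ U, so a positive rule meets a positive or a negative
-- rule and the cut moves to the immediate subformulas; two negative rules cannot meet, since
-- an ultrafilter containing ∁R₁ and ∁R₂ would contain ∅. The exception is !-promotion against
-- the negative ! rules: contraction copies the negative occurrence, so the promoted formula
-- is cut against all copies at once.

module Submission where

open import Defs
open import Level using (Level)
open import Data.Nat using (ℕ; zero; suc)
open import Data.Vec using (Vec; []; _∷_)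
open import Data.List using (List; []; _∷_; _++_; [_]; map)
open import Data.List.Properties using (map-++; map-∘; map-cong; map-id)
open import Data.List.Relation.Unary.All as All using (All; []; _∷_)
import Data.List.Relation.Unary.All.Properties as All
open import Data.List.Relation.Unary.Any using (Any; here; there)
import Data.List.Relation.Unary.Any.Properties as Any
open import Data.List.Relation.Unary.AllPairs using (_∷_)
import Data.List.Relation.Unary.AllPairs.Properties as AllPairs
open import Data.List.Membership.Propositional using (_∈_)
open import Data.List.Membership.Propositional.Properties using (∈-∃++; ∈-++⁻)
open import Data.List.Relation.Binary.Permutation.Propositional
  using (_↭_; ↭-refl; ↭-sym; ↭-trans; ↭-prep; ↭-swap; ↭-reflexive; ↭⇒↭ₛ)
import Data.List.Relation.Binary.Permutation.Propositional.Properties as ↭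
import Data.List.Relation.Binary.Permutation.Setoid.Properties as ↭ₛ
open import Data.Product using (_×_; _,_; ∃; proj₁; proj₂)
open import Data.Sum using (_⊎_; inj₁; inj₂)
open import Data.Empty using (⊥; ⊥-elim)
open import Data.Unit.Polymorphic using (⊤; tt)
open import Function using (_∘_; id)
open import Relation.Nullary using (¬_)
open import Relation.Unary using (Empty; _⊆_; _∩_; ∁; _≐_)
open import Relation.Unary.Properties using (≐-refl)
open import Relation.Binary.Definitions using (Symmetric; _Respects₂_)
open import Relation.Binary.PropositionalEquality
  using (_≡_; _≗_; refl; sym; trans; cong; cong₂; subst; subst₂; setoid; module ≡-Reasoning)


module _ {Sg : Signature} where

  mutual
    subT-cong : ∀ {σ τ : ℕ → Term Sg} → σ ≗ τ → subT Sg σ ≗ subT Sg τ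
    subT-cong e (var x)    = e x
    subT-cong e (fun g ts) = cong (fun g) (subTs-cong e ts)

    subTs-cong : ∀ {k} {σ τ : ℕ → Term Sg} → σ ≗ τ →
                 (ts : Vec (Term Sg) k) → subTs Sg σ ts ≡ subTs Sg τ ts
    subTs-cong e []       = refl
    subTs-cong e (t ∷ ts) = cong₂ _∷_ (subT-cong e t) (subTs-cong e ts)

  mutual
    subT-subT : ∀ σ τ → subT Sg σ ∘ subT Sg τ ≗ subT Sg (subT Sg σ ∘ τ)
    subT-subT σ τ (var x)    = refl
    subT-subT σ τ (fun g ts) = cong (fun g) (subTs-subTs σ τ ts)

    subTs-subTs : ∀ {k} σ τ (ts : Vec (Term Sg) k) →
                  subTs Sg σ (subTs Sg τ ts) ≡ subTs Sg (subT Sg σ ∘ τ) ts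
    subTs-subTs σ τ []       = refl
    subTs-subTs σ τ (t ∷ ts) = cong₂ _∷_ (subT-subT σ τ t) (subTs-subTs σ τ ts)

  mutual
    subT-renT : ∀ σ ρ → subT Sg σ ∘ renT Sg ρ ≗ subT Sg (σ ∘ ρ)
    subT-renT σ ρ (var x)    = refl
    subT-renT σ ρ (fun g ts) = cong (fun g) (subTs-renTs σ ρ ts)

    subTs-renTs : ∀ {k} σ ρ (ts : Vec (Term Sg) k) →
                  subTs Sg σ (renTs Sg ρ ts) ≡ subTs Sg (σ ∘ ρ) ts
    subTs-renTs σ ρ []       = refl
    subTs-renTs σ ρ (t ∷ ts) = cong₂ _∷_ (subT-renT σ ρ t) (subTs-renTs σ ρ ts)

  mutual
    renT-subT : ∀ ρ σ → renT Sg ρ ∘ subT Sg σ ≗ subT Sg (renT Sg ρ ∘ σ)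
    renT-subT ρ σ (var x)    = refl
    renT-subT ρ σ (fun g ts) = cong (fun g) (renTs-subTs ρ σ ts)

    renTs-subTs : ∀ {k} ρ σ (ts : Vec (Term Sg) k) →
                  renTs Sg ρ (subTs Sg σ ts) ≡ subTs Sg (renT Sg ρ ∘ σ) ts
    renTs-subTs ρ σ []       = refl
    renTs-subTs ρ σ (t ∷ ts) = cong₂ _∷_ (renT-subT ρ σ t) (renTs-subTs ρ σ ts)

  mutual
    subT-var : subT Sg var ≗ id
    subT-var (var x)    = refl
    subT-var (fun g ts) = cong (fun g) (subTs-var ts)

    subTs-var : ∀ {k} (ts : Vec (Term Sg) k) → subTs Sg var ts ≡ ts
    subTs-var []       = refl
    subTs-var (t ∷ ts) = cong₂ _∷_ (subT-var t) (subTs-var ts)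

  mutual
    renT≗subT : ∀ ρ → renT Sg ρ ≗ subT Sg (var ∘ ρ)
    renT≗subT ρ (var x)    = refl
    renT≗subT ρ (fun g ts) = cong (fun g) (renTs≗subTs ρ ts)

    renTs≗subTs : ∀ {k} ρ (ts : Vec (Term Sg) k) → renTs Sg ρ ts ≡ subTs Sg (var ∘ ρ) ts
    renTs≗subTs ρ []       = refl
    renTs≗subTs ρ (t ∷ ts) = cong₂ _∷_ (renT≗subT ρ t) (renTs≗subTs ρ ts)

  liftS-cong : ∀ {σ τ : ℕ → Term Sg} → σ ≗ τ → liftS Sg σ ≗ liftS Sg τ
  liftS-cong e zero    = refl
  liftS-cong e (suc x) = cong (renT Sg suc) (e x)

  liftS-subT : ∀ σ τ → subT Sg (liftS Sg σ) ∘ liftS Sg τ ≗ liftS Sg (subT Sg σ ∘ τ)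
  liftS-subT σ τ zero    = refl
  liftS-subT σ τ (suc x) = trans (subT-renT _ suc (τ x)) (sym (renT-subT suc σ (τ x)))

  liftS-var : liftS Sg var ≗ var
  liftS-var zero    = refl
  liftS-var (suc x) = refl

  liftR≗liftS : ∀ ρ → var ∘ liftR Sg ρ ≗ liftS Sg (var ∘ ρ)
  liftR≗liftS ρ zero    = refl
  liftR≗liftS ρ (suc x) = refl

  module _ {Ω : Set} where

    subF-cong : ∀ {σ τ : ℕ → Term Sg} → σ ≗ τ → subF Sg {Ω} σ ≗ subF Sg τ
    subF-cong e (atom P ts)    = cong (atom P) (subTs-cong e ts)
    subF-cong e (neg f A)      = cong (neg f) (subF-cong e A)
    subF-cong e (tensor U A B) = cong₂ (tensor U) (subF-cong e A) (subF-cong e B)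
    subF-cong e (with′ U A B)  = cong₂ (with′ U) (subF-cong e A) (subF-cong e B)
    subF-cong e (bang U A)     = cong (bang U) (subF-cong e A)
    subF-cong e (all U A)      = cong (all U) (subF-cong (liftS-cong e) A)

    subF-subF : ∀ σ τ → subF Sg {Ω} σ ∘ subF Sg τ ≗ subF Sg (subT Sg σ ∘ τ)
    subF-subF σ τ (atom P ts)    = cong (atom P) (subTs-subTs σ τ ts)
    subF-subF σ τ (neg f A)      = cong (neg f) (subF-subF σ τ A)
    subF-subF σ τ (tensor U A B) = cong₂ (tensor U) (subF-subF σ τ A) (subF-subF σ τ B)
    subF-subF σ τ (with′ U A B)  = cong₂ (with′ U) (subF-subF σ τ A) (subF-subF σ τ B)
    subF-subF σ τ (bang U A)     = cong (bang U) (subF-subF σ τ A)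
    subF-subF σ τ (all U A)      =
      cong (all U) (trans (subF-subF _ _ A) (subF-cong (liftS-subT σ τ) A))

    subF-var : subF Sg {Ω} var ≗ id
    subF-var (atom P ts)    = cong (atom P) (subTs-var ts)
    subF-var (neg f A)      = cong (neg f) (subF-var A)
    subF-var (tensor U A B) = cong₂ (tensor U) (subF-var A) (subF-var B)
    subF-var (with′ U A B)  = cong₂ (with′ U) (subF-var A) (subF-var B)
    subF-var (bang U A)     = cong (bang U) (subF-var A)
    subF-var (all U A)      = cong (all U) (trans (subF-cong liftS-var A) (subF-var A))

    renF≗subF : ∀ ρ → renF Sg {Ω} ρ ≗ subF Sg (var ∘ ρ)
    renF≗subF ρ (atom P ts)    = cong (atom P) (renTs≗subTs ρ ts)
    renF≗subF ρ (neg f A)      = cong (neg f) (renF≗subF ρ A)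
    renF≗subF ρ (tensor U A B) = cong₂ (tensor U) (renF≗subF ρ A) (renF≗subF ρ B)
    renF≗subF ρ (with′ U A B)  = cong₂ (with′ U) (renF≗subF ρ A) (renF≗subF ρ B)
    renF≗subF ρ (bang U A)     = cong (bang U) (renF≗subF ρ A)
    renF≗subF ρ (all U A)      =
      cong (all U) (trans (renF≗subF (liftR Sg ρ) A) (subF-cong (liftR≗liftS ρ) A))

    subF-inst : ∀ σ (A : Formula Sg Ω) t →
                subF Sg σ (inst Sg A t) ≡ inst Sg (subF Sg (liftS Sg σ) A) (subT Sg σ t)
    subF-inst σ A t = begin
      subF Sg σ (subF Sg (single Sg t) A)                        ≡⟨ subF-subF σ _ A ⟩
      subF Sg (subT Sg σ ∘ single Sg t) A                        ≡⟨ subF-cong single-lift A ⟩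
      subF Sg (subT Sg (single Sg (subT Sg σ t)) ∘ liftS Sg σ) A ≡⟨ subF-subF _ _ A ⟨
      subF Sg (single Sg (subT Sg σ t)) (subF Sg (liftS Sg σ) A) ∎
      where
      open ≡-Reasoning
      single-lift : subT Sg σ ∘ single Sg t ≗ subT Sg (single Sg (subT Sg σ t)) ∘ liftS Sg σ
      single-lift zero    = refl
      single-lift (suc x) = sym (trans (subT-renT _ suc (σ x)) (subT-var (σ x)))

    subF-liftS-shift : ∀ σ (A : Formula Sg Ω) →
                       subF Sg (liftS Sg σ) (renF Sg suc A) ≡ renF Sg suc (subF Sg σ A)
    subF-liftS-shift σ A = begin
      subF Sg (liftS Sg σ) (renF Sg suc A)         ≡⟨ cong (subF Sg _) (renF≗subF suc A) ⟩
      subF Sg (liftS Sg σ) (subF Sg (var ∘ suc) A) ≡⟨ subF-subF _ _ A ⟩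
      subF Sg (renT Sg suc ∘ σ) A                  ≡⟨ subF-cong (renT≗subT suc ∘ σ) A ⟩
      subF Sg (subT Sg (var ∘ suc) ∘ σ) A          ≡⟨ subF-subF _ σ A ⟨
      subF Sg (var ∘ suc) (subF Sg σ A)            ≡⟨ renF≗subF suc _ ⟨
      renF Sg suc (subF Sg σ A)                    ∎
      where open ≡-Reasoning

    inst-shift : ∀ t (A : Formula Sg Ω) → inst Sg (renF Sg suc A) t ≡ A
    inst-shift t A = begin
      subF Sg (single Sg t) (renF Sg suc A)         ≡⟨ cong (subF Sg _) (renF≗subF suc A) ⟩
      subF Sg (single Sg t) (subF Sg (var ∘ suc) A) ≡⟨ subF-subF _ _ A ⟩
      subF Sg var A                                 ≡⟨ subF-var A ⟩
      A                                             ∎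
      where open ≡-Reasoning

data Shape : Set where
  atomS           : Shape
  negS bangS allS : Shape → Shape
  tensorS withS   : Shape → Shape → Shape

module _ {Sg : Signature} {Ω : Set} where

  shape : Formula Sg Ω → Shape
  shape (atom P ts)    = atomS
  shape (neg f A)      = negS (shape A)
  shape (tensor U A B) = tensorS (shape A) (shape B)
  shape (with′ U A B)  = withS (shape A) (shape B)
  shape (bang U A)     = bangS (shape A)
  shape (all U A)      = allS (shape A)

  shape-subF : ∀ σ (A : Formula Sg Ω) → shape (subF Sg σ A) ≡ shape A
  shape-subF σ (atom P ts)    = refl
  shape-subF σ (neg f A)      = cong negS (shape-subF σ A)
  shape-subF σ (tensor U A B) = cong₂ tensorS (shape-subF σ A) (shape-subF σ B)
  shape-subF σ (with′ U A B)  = cong₂ withS (shape-subF σ A) (shape-subF σ B)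
  shape-subF σ (bang U A)     = cong bangS (shape-subF σ A)
  shape-subF σ (all U A)      = cong allS (shape-subF (liftS Sg σ) A)

  shape-renF : ∀ ρ (A : Formula Sg Ω) → shape (renF Sg ρ A) ≡ shape A
  shape-renF ρ A = trans (cong shape (renF≗subF ρ A)) (shape-subF (var ∘ ρ) A)

module _ {a : Level} {A : Set a} where

  ∈⇒↭∷ : ∀ {x : A} {xs} → x ∈ xs → ∃ λ ys → xs ↭ x ∷ ys
  ∈⇒↭∷ {x} x∈xs with as , bs , refl ← ∈-∃++ x∈xs = as ++ bs , ↭.shift x as bs

  ↭-keep-front : ∀ ps {xs cs ys : List A} → xs ↭ cs ++ ys → ps ++ xs ↭ cs ++ ps ++ ys
  ↭-keep-front ps {cs = cs} p = ↭-trans (↭.++⁺ˡ ps p) (↭.shifts ps cs)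

  ↭-keep-head : ∀ ps {x : A} {xs ys} → xs ↭ x ∷ ys → ps ++ xs ↭ x ∷ ps ++ ys
  ↭-keep-head ps = ↭-keep-front ps {cs = [ _ ]}

  data HeadSplit (x : A) (xs : List A) : A → List A → Set a where
    same-head  : ∀ {ys} → xs ↭ ys → HeadSplit x xs x ys
    other-head : ∀ {y ys} zs → x ∷ zs ↭ ys → xs ↭ y ∷ zs → HeadSplit x xs y ys

  headSplit : ∀ {x y : A} {xs ys} → x ∷ xs ↭ y ∷ ys → HeadSplit x xs y ys
  headSplit {x} {y} p with ↭.∈-resp-↭ (↭-sym p) (here refl)
  ... | here refl = same-head (↭.drop-∷ p)
  ... | there y∈xs with zs , q ← ∈⇒↭∷ y∈xs =
    other-head zs (↭.drop-∷ (↭-trans (↭-swap y x ↭-refl) (↭-trans (↭-prep x (↭-sym q)) p))) q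

  data AppendSplit (xs ys : List A) (z : A) (zs : List A) : Set a where
    in-left  : ∀ xs′ → xs ↭ z ∷ xs′ → xs′ ++ ys ↭ zs → AppendSplit xs ys z zs
    in-right : ∀ ys′ → ys ↭ z ∷ ys′ → xs ++ ys′ ↭ zs → AppendSplit xs ys z zs

  appendSplit : ∀ xs ys {z : A} {zs} → xs ++ ys ↭ z ∷ zs → AppendSplit xs ys z zs
  appendSplit xs ys {z} p with ∈-++⁻ xs (↭.∈-resp-↭ (↭-sym p) (here refl))
  ... | inj₁ z∈xs with xs′ , q ← ∈⇒↭∷ z∈xs =
    in-left xs′ q (↭.drop-∷ (↭-trans (↭.++⁺ʳ ys (↭-sym q)) p))
  ... | inj₂ z∈ys with ys′ , q ← ∈⇒↭∷ z∈ys =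
    in-right ys′ q (↭.drop-∷ (↭-trans (↭-sym (↭.shift z xs ys′)) (↭-trans (↭.++⁺ˡ xs (↭-sym q)) p)))

  Copies : A → List A → Set a
  Copies c = All (_≡ c)

  data CopiesHeadSplit (c x : A) (xs cs ys : List A) : Set a where
    copy-head  : ∀ cs′ → x ≡ c → Copies c cs′ → xs ↭ cs′ ++ ys → CopiesHeadSplit c x xs cs ys
    other-head : ∀ zs → x ∷ zs ↭ ys → xs ↭ cs ++ zs → CopiesHeadSplit c x xs cs ys

  copiesHeadSplit : ∀ {c x : A} {xs cs ys} → Copies c cs → x ∷ xs ↭ cs ++ ys →
                    CopiesHeadSplit c x xs cs ys
  copiesHeadSplit {x = x} {cs = cs} {ys} cs≡c p with ∈-++⁻ cs (↭.∈-resp-↭ p (here refl))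
  ... | inj₁ x∈cs with as , bs , refl ← ∈-∃++ x∈cs
                  with as≡c , (x≡c ∷ bs≡c) ← All.++⁻ as cs≡c =
    copy-head (as ++ bs) x≡c (All.++⁺ as≡c bs≡c)
      (↭.drop-∷ (↭-trans p (↭-trans (↭.++-assoc as (x ∷ bs) ys)
        (↭-trans (↭.shift x as (bs ++ ys)) (↭-prep x (↭-sym (↭.++-assoc as bs ys)))))))
  ... | inj₂ x∈ys with zs , q ← ∈⇒↭∷ x∈ys =
    other-head zs (↭-sym q) (↭.drop-∷ (↭-trans p (↭-trans (↭.++⁺ˡ cs q) (↭.shift x cs zs))))

  data CopiesAppendSplit (c : A) (xs ys zs : List A) : Set a where
    copiesSplit : ∀ {csˡ csʳ zsˡ zsʳ} → Copies c csˡ → Copies c csʳ →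
                  xs ↭ csˡ ++ zsˡ → ys ↭ csʳ ++ zsʳ → zsˡ ++ zsʳ ↭ zs →
                  CopiesAppendSplit c xs ys zs

  copiesAppendSplit : ∀ {c : A} xs ys {cs zs} → Copies c cs → xs ++ ys ↭ cs ++ zs →
                      CopiesAppendSplit c xs ys zs
  copiesAppendSplit xs ys [] p = copiesSplit [] [] ↭-refl ↭-refl p
  copiesAppendSplit xs ys {x ∷ _} (x≡c ∷ cs≡c) p with appendSplit xs ys p
  ... | in-left xs′ q r
      with copiesSplit aˡ aʳ sˡ sʳ t ← copiesAppendSplit xs′ ys cs≡c r =
    copiesSplit (x≡c ∷ aˡ) aʳ (↭-trans q (↭-prep x sˡ)) sʳ t
  ... | in-right ys′ q r
      with copiesSplit aˡ aʳ sˡ sʳ t ← copiesAppendSplit xs ys′ cs≡c r =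
    copiesSplit aˡ (x≡c ∷ aʳ) sˡ (↭-trans q (↭-prep x sʳ)) t

module _ {Ω : Set} where

  Cover : RoleSet Ω → RoleSet Ω → Set
  Cover R₁ R₂ = Empty (∁ R₁ ∩ ∁ R₂)

  Disjoint : RoleSet Ω → RoleSet Ω → Set
  Disjoint R S = ∀ r → ¬ (R r × S r)

  cover-sym : ∀ {R₁ R₂} → Cover R₁ R₂ → Cover R₂ R₁
  cover-sym c r (a , b) = c r (b , a)

  cover-mem : ∀ {R₁ R₂} → Cover R₁ R₂ → (U : Ultrafilter Ω) → mem U R₁ ⊎ mem U R₂
  cover-mem {R₁} {R₂} c U with ultra U R₁ | ultra U R₂
  ... | inj₁ m₁ | _       = inj₁ m₁
  ... | inj₂ _  | inj₁ m₂ = inj₂ m₂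
  ... | inj₂ n₁ | inj₂ n₂ = inj₁ (up U (λ {r} r∈∁ → ⊥-elim (c r r∈∁)) (inter U n₁ n₂))

  cover-¬mem : ∀ {R₁ R₂} → Cover R₁ R₂ → (U : Ultrafilter Ω) → ¬ mem U R₁ → ¬ mem U R₂ → ⊥
  cover-¬mem c U n₁ n₂ with cover-mem c U
  ... | inj₁ m₁ = n₁ m₁
  ... | inj₂ m₂ = n₂ m₂

  ¬mem-⊆ : ∀ {R S} (U : Ultrafilter Ω) → S ⊆ R → ¬ mem U R → ¬ mem U S
  ¬mem-⊆ U S⊆R n m = n (up U S⊆R m)

  partition-↭ : ∀ {Rs Rs′} → Rs ↭ Rs′ → Partition Rs → Partition Rs′
  partition-↭ p (#Rs , cov) =
    ↭ₛ.AllPairs-resp-↭ (setoid (RoleSet Ω)) #-sym #-resp (↭⇒↭ₛ p) #Rs ,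
    λ r → ↭.Any-resp-↭ p (cov r)
    where
    #-sym : Symmetric Disjoint
    #-sym R#S r (s , r′) = R#S r (r′ , s)
    #-resp : Disjoint Respects₂ _≡_
    #-resp = (λ { refl d → d }) , (λ { refl d → d })

  module _ {S R₁ R₂ : RoleSet Ω} (S≐ : S ≐ R₁ ∩ R₂) where

    ≐∩-⊆ˡ : S ⊆ R₁
    ≐∩-⊆ˡ s = proj₁ (proj₁ S≐ s)

    ≐∩-⊆ʳ : S ⊆ R₂
    ≐∩-⊆ʳ s = proj₂ (proj₁ S≐ s)

    ≐∩-comm : S ≐ R₂ ∩ R₁
    ≐∩-comm = (λ s → ≐∩-⊆ʳ s , ≐∩-⊆ˡ s) , (λ (r₂ , r₁) → proj₂ S≐ (r₁ , r₂))

    ≐∩-preimage : (f : Ω → Ω) → preimage f S ≐ preimage f R₁ ∩ preimage f R₂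
    ≐∩-preimage f = proj₁ S≐ , proj₂ S≐

    mem-≐∩ : (U : Ultrafilter Ω) → mem U R₁ → mem U R₂ → mem U S
    mem-≐∩ U m₁ m₂ = up U (proj₂ S≐) (inter U m₁ m₂)

    partition-merge : ∀ {L M} → Cover R₁ R₂ →
                      Partition (R₁ ∷ L) → Partition (R₂ ∷ M) → Partition (S ∷ L ++ M)
    partition-merge {L} {M} c (R₁#L ∷ #L , cov₁) (R₂#M ∷ #M , cov₂) =
      (All.++⁺ (All.map (disjoint-⊆ ≐∩-⊆ˡ) R₁#L) (All.map (disjoint-⊆ ≐∩-⊆ʳ) R₂#M) ∷
       AllPairs.++⁺ #L #M (All.map (λ R₁#X → All.map (across R₁#X) R₂#M) R₁#L)) ,
      covered
      where
      disjoint-⊆ : ∀ {X Y} → S ⊆ X → Disjoint X Y → Disjoint S Y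
      disjoint-⊆ S⊆X X#Y r (s , y) = X#Y r (S⊆X s , y)

      across : ∀ {X Y} → Disjoint R₁ X → Disjoint R₂ Y → Disjoint X Y
      across R₁#X R₂#Y r (x , y) = c r ((λ r₁ → R₁#X r (r₁ , x)) , (λ r₂ → R₂#Y r (r₂ , y)))

      covered : ∀ r → Any (λ X → X r) (S ∷ L ++ M)
      covered r with cov₁ r | cov₂ r
      ... | here r₁   | here r₂   = here (proj₂ S≐ (r₁ , r₂))
      ... | there r∈L | _         = there (Any.++⁺ˡ r∈L)
      ... | here _    | there r∈M = there (Any.++⁺ʳ L r∈M)

module _ {Sg : Signature} {Ω : Set} where

  private
    Seq    = Sequent Sg Ω
    Der    = Derivable Sg Ω
    WhyNot = IsWhyNot Sg Ω
    shI    = shiftI Sg Ω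

  open import Algebra.Solver.CommutativeMonoid (↭.++-commutativeMonoid {A = IFormula Sg Ω})
    using (solve; _⊜_; _⊕_)

  exch-prefix : ∀ {Γ Γ′ Θ} → Γ ↭ Γ′ → Der (Γ ++ Θ) → Der (Γ′ ++ Θ)
  exch-prefix p = exch (↭.++⁺ʳ _ p)

  map-shiftI-++ : ∀ {X} Γ Θ → Der (X ∷ map shI Γ ++ map shI Θ) → Der (X ∷ map shI (Γ ++ Θ))
  map-shiftI-++ Γ Θ = subst (λ Δ → Der (_ ∷ Δ)) (sym (map-++ shI Γ Θ))

  weaken-whyNot : ∀ {Θ Γ} → All WhyNot Θ → Der Γ → Der (Θ ++ Γ)
  weaken-whyNot []              D = D
  weaken-whyNot (whyNot n ∷ wΘ) D = bang-weaken n (weaken-whyNot wΘ D)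

  contract-whyNot : ∀ {Θ Γ} → All WhyNot Θ → Der (Θ ++ Θ ++ Γ) → Der (Θ ++ Γ)
  contract-whyNot [] D = D
  contract-whyNot {X ∷ Θ} {Γ} (whyNot n ∷ wΘ) D =
    exch (↭.shift X Θ Γ) (contract-whyNot wΘ (exch X-inward (bang-contract n (exch X-outward D))))
    where
    X-outward : X ∷ Θ ++ X ∷ Θ ++ Γ ↭ X ∷ X ∷ Θ ++ Θ ++ Γ
    X-outward = ↭-prep X (↭.shift X Θ (Θ ++ Γ))
    X-inward : X ∷ Θ ++ Θ ++ Γ ↭ Θ ++ Θ ++ X ∷ Γ
    X-inward = ↭-trans (↭.shifts (X ∷ []) Θ) (↭.++⁺ˡ Θ (↭-sym (↭.shift X Θ Γ)))

  tensor-pos-shared : ∀ {R U A B Γ₁ Γ₂ Θ} → All WhyNot Θ → mem U R →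
                      Der (R ▹ A ∷ Γ₁ ++ Θ) → Der (R ▹ B ∷ Γ₂ ++ Θ) →
                      Der (R ▹ tensor U A B ∷ (Γ₁ ++ Γ₂) ++ Θ)
  tensor-pos-shared {R} {U} {A} {B} {Γ₁} {Γ₂} {Θ} wΘ m D₁ D₂ =
    exch Θ-last (contract-whyNot wΘ (exch Θ-first (tensor-pos m D₁ D₂)))
    where
    X = R ▹ tensor U A B
    Θ-first : X ∷ (Γ₁ ++ Θ) ++ (Γ₂ ++ Θ) ↭ Θ ++ Θ ++ X ∷ Γ₁ ++ Γ₂
    Θ-first = solve 4 (λ x γ₁ γ₂ θ → (x ⊕ (γ₁ ⊕ θ)) ⊕ (γ₂ ⊕ θ) ⊜ θ ⊕ (θ ⊕ (x ⊕ (γ₁ ⊕ γ₂))))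
                ↭-refl [ X ] Γ₁ Γ₂ Θ
    Θ-last : Θ ++ X ∷ Γ₁ ++ Γ₂ ↭ X ∷ (Γ₁ ++ Γ₂) ++ Θ
    Θ-last = solve 4 (λ x γ₁ γ₂ θ → θ ⊕ (x ⊕ (γ₁ ⊕ γ₂)) ⊜ x ⊕ ((γ₁ ⊕ γ₂) ⊕ θ))
                ↭-refl [ X ] Γ₁ Γ₂ Θ

  whyNot-renF⁻ : ∀ {R} ρ (A : Formula Sg Ω) → WhyNot (R ▹ renF Sg ρ A) → WhyNot (R ▹ A)
  whyNot-renF⁻ ρ (bang U A)     (whyNot n) = whyNot n
  whyNot-renF⁻ ρ (atom _ _)     ()
  whyNot-renF⁻ ρ (neg _ _)      ()
  whyNot-renF⁻ ρ (tensor _ _ _) ()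
  whyNot-renF⁻ ρ (with′ _ _ _)  ()
  whyNot-renF⁻ ρ (all _ _)      ()

  ¬whyNot-one-side : ∀ {R₁ R₂} → Cover R₁ R₂ → (A : Formula Sg Ω) →
                     ¬ WhyNot (R₁ ▹ A) ⊎ ¬ WhyNot (R₂ ▹ A)
  ¬whyNot-one-side c (bang U A) with cover-mem c U
  ... | inj₁ m₁ = inj₁ λ { (whyNot n₁) → n₁ m₁ }
  ... | inj₂ m₂ = inj₂ λ { (whyNot n₂) → n₂ m₂ }
  ¬whyNot-one-side c (atom _ _)     = inj₁ λ ()
  ¬whyNot-one-side c (neg _ _)      = inj₁ λ ()
  ¬whyNot-one-side c (tensor _ _ _) = inj₁ λ ()
  ¬whyNot-one-side c (with′ _ _ _)  = inj₁ λ ()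
  ¬whyNot-one-side c (all _ _)      = inj₁ λ ()

  subI : (ℕ → Term Sg) → IFormula Sg Ω → IFormula Sg Ω
  subI σ (R ▹ A) = R ▹ subF Sg σ A

  subI-var-suc : ∀ X → subI (var ∘ suc) X ≡ shI X
  subI-var-suc (R ▹ A) = cong (R ▹_) (sym (renF≗subF suc A))

  whyNot-subI : ∀ σ {X} → WhyNot X → WhyNot (subI σ X)
  whyNot-subI σ (whyNot n) = whyNot n

  whyNot-shiftI : ∀ {X} → WhyNot X → WhyNot (shI X)
  whyNot-shiftI (whyNot n) = whyNot n

  map-subI-shiftI : ∀ σ (Γ : Seq) →
                    map (subI (liftS Sg σ)) (map shI Γ) ≡ map shI (map (subI σ) Γ)
  map-subI-shiftI σ Γ = begin
    map (subI (liftS Sg σ)) (map shI Γ) ≡⟨ map-∘ Γ ⟨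
    map (subI (liftS Sg σ) ∘ shI) Γ     ≡⟨ map-cong subI-shiftI Γ ⟩
    map (shI ∘ subI σ) Γ                ≡⟨ map-∘ Γ ⟩
    map shI (map (subI σ) Γ)            ∎
    where
    open ≡-Reasoning
    subI-shiftI : ∀ X → subI (liftS Sg σ) (shI X) ≡ shI (subI σ X)
    subI-shiftI (R ▹ A) = cong (R ▹_) (subF-liftS-shift σ A)

  map-subI-single-shiftI : ∀ t (Γ : Seq) → map (subI (single Sg t)) (map shI Γ) ≡ Γ
  map-subI-single-shiftI t Γ = begin
    map (subI (single Sg t)) (map shI Γ) ≡⟨ map-∘ Γ ⟨
    map (subI (single Sg t) ∘ shI) Γ     ≡⟨ map-cong subI-single-shiftI Γ ⟩
    map id Γ                             ≡⟨ map-id Γ ⟩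
    Γ                                    ∎
    where
    open ≡-Reasoning
    subI-single-shiftI : ∀ X → subI (single Sg t) (shI X) ≡ X
    subI-single-shiftI (R ▹ A) = cong (R ▹_) (inst-shift t A)

  derivable-sub : ∀ σ {Γ} → Der Γ → Der (map (subI σ) Γ)
  derivable-sub σ (ax Rs P ts part) = subst Der (map-∘ Rs) (ax Rs P (subTs Sg σ ts) part)
  derivable-sub σ (exch p D)          = exch (↭.map⁺ (subI σ) p) (derivable-sub σ D)
  derivable-sub σ (negR D)            = negR (derivable-sub σ D)
  derivable-sub σ (with-neg-l n D)    = with-neg-l n (derivable-sub σ D)
  derivable-sub σ (with-neg-r n D)    = with-neg-r n (derivable-sub σ D)
  derivable-sub σ (with-pos m D E)    = with-pos m (derivable-sub σ D) (derivable-sub σ E)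
  derivable-sub σ (tensor-neg n D)    = tensor-neg n (derivable-sub σ D)
  derivable-sub σ (tensor-pos {Γ₁} {Γ₂} m D E) =
    subst (λ Γ → Der (_ ∷ Γ)) (sym (map-++ (subI σ) Γ₁ Γ₂))
      (tensor-pos m (derivable-sub σ D) (derivable-sub σ E))
  derivable-sub σ (bang-pos m w D)    =
    bang-pos m (All.map⁺ (All.map (whyNot-subI σ) w)) (derivable-sub σ D)
  derivable-sub σ (bang-weaken n D)   = bang-weaken n (derivable-sub σ D)
  derivable-sub σ (bang-derelict n D) = bang-derelict n (derivable-sub σ D)
  derivable-sub σ (bang-contract n D) = bang-contract n (derivable-sub σ D)
  derivable-sub σ (all-neg {Γ} {R} {A = A} n t D) =
    all-neg n (subT Sg σ t)
      (subst (λ B → Der (R ▹ B ∷ map (subI σ) Γ)) (subF-inst σ A t) (derivable-sub σ D))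
  derivable-sub σ (all-pos {Γ} m D) =
    all-pos m (subst (λ Δ → Der (_ ∷ Δ)) (map-subI-shiftI σ Γ) (derivable-sub (liftS Sg σ) D))

  derivable-shift : ∀ {Γ} → Der Γ → Der (map shI Γ)
  derivable-shift {Γ} D = subst Der (map-cong subI-var-suc Γ) (derivable-sub (var ∘ suc) D)

  derivable-inst : ∀ {R A Γ} t → Der (R ▹ A ∷ map shI Γ) → Der (R ▹ inst Sg A t ∷ Γ)
  derivable-inst {Γ = Γ} t D =
    subst (λ Δ → Der (_ ∷ Δ)) (map-subI-single-shiftI t Γ) (derivable-sub (single Sg t) D)

  -- i-bang-neg covers all three negative ! rules: cutting a promoted formula against them needs
  -- the whole derivation (see multicut-bang).
  data Intro : RoleSet Ω → Formula Sg Ω → Seq → Set₁ where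
    i-ax : ∀ {R P ts L} → Partition (R ∷ L) →
           Intro R (atom P ts) (map (λ R′ → R′ ▹ atom P ts) L)
    i-neg : ∀ {R f A Γ} → Der (preimage f R ▹ A ∷ Γ) → Intro R (neg f A) Γ
    i-with-neg-l : ∀ {R U A B Γ} → ¬ mem U R → Der (R ▹ A ∷ Γ) → Intro R (with′ U A B) Γ
    i-with-neg-r : ∀ {R U A B Γ} → ¬ mem U R → Der (R ▹ B ∷ Γ) → Intro R (with′ U A B) Γ
    i-with-pos : ∀ {R U A B Γ} → mem U R → Der (R ▹ A ∷ Γ) → Der (R ▹ B ∷ Γ) →
                 Intro R (with′ U A B) Γ
    i-tensor-neg : ∀ {R U A B Γ} → ¬ mem U R → Der (R ▹ A ∷ R ▹ B ∷ Γ) →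
                   Intro R (tensor U A B) Γ
    i-tensor-pos : ∀ {R U A B Γ₁ Γ₂} → mem U R → Der (R ▹ A ∷ Γ₁) → Der (R ▹ B ∷ Γ₂) →
                   Intro R (tensor U A B) (Γ₁ ++ Γ₂)
    i-bang-pos : ∀ {R U A Γ} → mem U R → All WhyNot Γ → Der (R ▹ A ∷ Γ) →
                 Intro R (bang U A) Γ
    i-bang-neg : ∀ {R U A Γ} → ¬ mem U R → Der (R ▹ bang U A ∷ Γ) → Intro R (bang U A) Γ
    i-all-neg : ∀ {R U A Γ} → ¬ mem U R → (t : Term Sg) → Der (R ▹ inst Sg A t ∷ Γ) →
                Intro R (all U A) Γ
    i-all-pos : ∀ {R U A Γ} → mem U R → Der (R ▹ A ∷ map shI Γ) → Intro R (all U A) Γ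

  ax-inversion : ∀ {Rs P ts R A Γ} → Partition Rs →
                 map (λ R′ → R′ ▹ atom P ts) Rs ↭ R ▹ A ∷ Γ → Intro R A Γ
  ax-inversion part p with ↭.↭-map-inv _ p
  ... | []    , () , _
  ... | _ ∷ _ , refl , q = i-ax (partition-↭ q part)

  intro-sub : ∀ σ {R A Γ} → Intro R A Γ → Intro R (subF Sg σ A) (map (subI σ) Γ)
  intro-sub σ (i-ax {R} {P} {ts} {L} part) =
    subst (Intro R (atom P (subTs Sg σ ts))) (map-∘ L) (i-ax part)
  intro-sub σ (i-neg D)          = i-neg (derivable-sub σ D)
  intro-sub σ (i-with-neg-l n D) = i-with-neg-l n (derivable-sub σ D)
  intro-sub σ (i-with-neg-r n D) = i-with-neg-r n (derivable-sub σ D)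
  intro-sub σ (i-with-pos m D E) = i-with-pos m (derivable-sub σ D) (derivable-sub σ E)
  intro-sub σ (i-tensor-neg n D) = i-tensor-neg n (derivable-sub σ D)
  intro-sub σ (i-tensor-pos {Γ₁ = Γ₁} {Γ₂} m D E) =
    subst (Intro _ _) (sym (map-++ (subI σ) Γ₁ Γ₂))
      (i-tensor-pos m (derivable-sub σ D) (derivable-sub σ E))
  intro-sub σ (i-bang-pos m w D) =
    i-bang-pos m (All.map⁺ (All.map (whyNot-subI σ) w)) (derivable-sub σ D)
  intro-sub σ (i-bang-neg n D)   = i-bang-neg n (derivable-sub σ D)
  intro-sub σ (i-all-neg {R} {A = A} {Γ} n t D) =
    i-all-neg n (subT Sg σ t)
      (subst (λ B → Der (R ▹ B ∷ map (subI σ) Γ)) (subF-inst σ A t) (derivable-sub σ D))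
  intro-sub σ (i-all-pos {Γ = Γ} m D) =
    i-all-pos m (subst (λ Δ → Der (_ ∷ Δ)) (map-subI-shiftI σ Γ) (derivable-sub (liftS Sg σ) D))

  intro-shift : ∀ {R A Γ} → Intro R A Γ → Intro R (renF Sg suc A) (map shI Γ)
  intro-shift {R} {A} {Γ} I =
    subst₂ (Intro R) (sym (renF≗subF suc A)) (map-cong subI-var-suc Γ) (intro-sub (var ∘ suc) I)

  -- S ranges over role sets equal to R₁ ∩ R₂ only extensionally, which makes the statement
  -- symmetric in the two premises.
  CutAt : Shape → Set₁
  CutAt s = ∀ {A} → shape A ≡ s → ∀ {R₁ R₂ S Γ₁ Γ₂} → Cover R₁ R₂ → S ≐ R₁ ∩ R₂ →
            Der (R₁ ▹ A ∷ Γ₁) → Der (R₂ ▹ A ∷ Γ₂) → Der (S ▹ A ∷ Γ₁ ++ Γ₂)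

  Below : Shape → Set₁
  Below atomS         = ⊤
  Below (negS s)      = CutAt s
  Below (bangS s)     = CutAt s
  Below (allS s)      = CutAt s
  Below (tensorS s t) = CutAt s × CutAt t
  Below (withS s t)   = CutAt s × CutAt t

  -- The context S{!_U(B)}, Γ₁ that replaces the copies is of why-not form, so it can be
  -- weakened away (no copies left) and contracted (copies in both premises of ⊗, and after
  -- dereliction).
  module _ {s : Shape} (cutB : CutAt s) {U : Ultrafilter Ω} {R₁ R₂ S : RoleSet Ω}
           (c : Cover R₁ R₂) (S≐ : S ≐ R₁ ∩ R₂) (n₂ : ¬ mem U R₂) where

    Promoted : Formula Sg Ω → Seq → Set₁
    Promoted B Γ₁ = shape B ≡ s × All WhyNot Γ₁ × Der (R₁ ▹ B ∷ Γ₁)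

    private
      ¬mem-S : ¬ mem U S
      ¬mem-S = ¬mem-⊆ U (≐∩-⊆ʳ S≐) n₂

      context-whyNot : ∀ {B Γ₁} → Promoted B Γ₁ → All WhyNot (S ▹ bang U B ∷ Γ₁)
      context-whyNot (_ , w₁ , _) = whyNot ¬mem-S ∷ w₁

      promoted-shift : ∀ {B Γ₁} → Promoted B Γ₁ → Promoted (renF Sg suc B) (map shI Γ₁)
      promoted-shift {B} (eB , w₁ , E) =
        trans (shape-renF suc B) eB , All.map⁺ (All.map whyNot-shiftI w₁) , derivable-shift E

    multicut-bang : ∀ {B Γ₁ Δ Cs Γ₂} → Promoted B Γ₁ →
                    Der Δ → Copies (R₂ ▹ bang U B) Cs → Δ ↭ Cs ++ Γ₂ →
                    Der (Γ₂ ++ S ▹ bang U B ∷ Γ₁)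
    multicut-bang {Γ₁ = Γ₁} {Γ₂ = Γ₂} π D [] p =
      exch (↭.++-comm (_ ∷ Γ₁) Γ₂) (weaken-whyNot (context-whyNot π) (exch p D))
    multicut-bang π (ax Rs P ts part) (refl ∷ _) p with ↭.↭-map-inv _ p
    ... | []    , () , _
    ... | _ ∷ _ , () , _
    multicut-bang π (exch q D) cs p = multicut-bang π D cs (↭-trans q p)
    multicut-bang π (negR D) cs p with copiesHeadSplit cs p
    ... | copy-head _ () _ _
    ... | other-head W r q = exch-prefix r (negR (multicut-bang π D cs (↭-keep-front [ _ ] q)))
    multicut-bang π (with-neg-l n D) cs p with copiesHeadSplit cs p
    ... | copy-head _ () _ _
    ... | other-head W r q =
      exch-prefix r (with-neg-l n (multicut-bang π D cs (↭-keep-front [ _ ] q)))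
    multicut-bang π (with-neg-r n D) cs p with copiesHeadSplit cs p
    ... | copy-head _ () _ _
    ... | other-head W r q =
      exch-prefix r (with-neg-r n (multicut-bang π D cs (↭-keep-front [ _ ] q)))
    multicut-bang π (with-pos m D₁ D₂) cs p with copiesHeadSplit cs p
    ... | copy-head _ () _ _
    ... | other-head W r q =
      exch-prefix r (with-pos m (multicut-bang π D₁ cs (↭-keep-front [ _ ] q))
                                (multicut-bang π D₂ cs (↭-keep-front [ _ ] q)))
    multicut-bang π (tensor-neg n D) cs p with copiesHeadSplit cs p
    ... | copy-head _ () _ _
    ... | other-head W r q =
      exch-prefix r (tensor-neg n (multicut-bang π D cs (↭-keep-front (_ ∷ _ ∷ []) q)))
    multicut-bang π (tensor-pos {Γa} {Γb} m D₁ D₂) cs p with copiesHeadSplit cs p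
    ... | copy-head _ () _ _
    ... | other-head W r q with copiesSplit cs₁ cs₂ q₁ q₂ qW ← copiesAppendSplit Γa Γb cs q =
      exch-prefix (↭-trans (↭-prep _ qW) r)
        (tensor-pos-shared (context-whyNot π) m
          (multicut-bang π D₁ cs₁ (↭-keep-front [ _ ] q₁))
          (multicut-bang π D₂ cs₂ (↭-keep-front [ _ ] q₂)))
    multicut-bang {Cs = Cs} π (bang-pos m w D) cs p with copiesHeadSplit cs p
    ... | copy-head _ refl _ _ = ⊥-elim (n₂ m)
    ... | other-head W r q =
      exch-prefix r
        (bang-pos m (All.++⁺ (All.++⁻ʳ Cs (↭.All-resp-↭ q w)) (context-whyNot π))
          (multicut-bang π D cs (↭-keep-front [ _ ] q)))
    multicut-bang π (bang-weaken n D) cs p with copiesHeadSplit cs p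
    ... | copy-head _ refl cs′ q = multicut-bang π D cs′ q
    ... | other-head W r q = exch-prefix r (bang-weaken n (multicut-bang π D cs q))
    multicut-bang {Γ₁ = Γ₁} {Γ₂ = Γ₂} π@(eB , _ , E) (bang-derelict n D) cs p
      with copiesHeadSplit cs p
    ... | copy-head _ refl cs′ q =
      exch (↭.++-comm Θ Γ₂) (contract-whyNot (context-whyNot π)
        (exch (↭.++⁺ˡ Θ (↭.++-comm Γ₂ Θ))
          (bang-derelict ¬mem-S (cutB eB c S≐ E (multicut-bang π D cs′ (↭-keep-front [ _ ] q))))))
      where Θ = S ▹ bang U _ ∷ Γ₁
    ... | other-head W r q =
      exch-prefix r (bang-derelict n (multicut-bang π D cs (↭-keep-front [ _ ] q)))
    multicut-bang π (bang-contract n D) cs p with copiesHeadSplit cs p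
    ... | copy-head _ refl cs′ q = multicut-bang π D (refl ∷ refl ∷ cs′) (↭-prep _ (↭-prep _ q))
    ... | other-head W r q =
      exch-prefix r (bang-contract n (multicut-bang π D cs (↭-keep-front (_ ∷ _ ∷ []) q)))
    multicut-bang π (all-neg n t D) cs p with copiesHeadSplit cs p
    ... | copy-head _ () _ _
    ... | other-head W r q =
      exch-prefix r (all-neg n t (multicut-bang π D cs (↭-keep-front [ _ ] q)))
    multicut-bang {B} {Γ₁} {Cs = Cs} π (all-pos m D) cs p with copiesHeadSplit cs p
    ... | copy-head _ () _ _
    ... | other-head W r q =
      exch-prefix r (all-pos m (map-shiftI-++ W (S ▹ bang U B ∷ Γ₁)
        (multicut-bang (promoted-shift π) D (All.map⁺ (All.map (cong shI) cs))
          (↭-keep-front [ _ ] (↭-trans (↭.map⁺ shI q) (↭-reflexive (map-++ shI Cs W)))))))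

  -- Permutes a cut on R{A} upwards until R{A} is principal; Partner A Γ′ is what the cut needs
  -- from the other premise, whose context is Γ′.
  module Commute {R S : RoleSet Ω} (Partner : Formula Sg Ω → Seq → Set₁)
    (partner-shift  : ∀ {A Γ′} → Partner A Γ′ → Partner (renF Sg suc A) (map shI Γ′))
    (partner-whyNot : ∀ {A Γ′} → WhyNot (R ▹ A) → Partner A Γ′ → All WhyNot (S ▹ A ∷ Γ′))
    (principal      : ∀ {A Γ Γ′} → Partner A Γ′ → Intro R A Γ → Der (Γ ++ S ▹ A ∷ Γ′))
    where

    commute : ∀ {A Γ Γ′ Δ} → Partner A Γ′ → Der Δ → Δ ↭ R ▹ A ∷ Γ → Der (Γ ++ S ▹ A ∷ Γ′)
    commute π (ax Rs P ts part) p = principal π (ax-inversion part p)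
    commute π (exch q D) p = commute π D (↭-trans q p)
    commute π (negR D) p with headSplit p
    ... | same-head q      = exch-prefix q (principal π (i-neg D))
    ... | other-head W r q = exch-prefix r (negR (commute π D (↭-keep-head [ _ ] q)))
    commute π (with-neg-l n D) p with headSplit p
    ... | same-head q      = exch-prefix q (principal π (i-with-neg-l n D))
    ... | other-head W r q = exch-prefix r (with-neg-l n (commute π D (↭-keep-head [ _ ] q)))
    commute π (with-neg-r n D) p with headSplit p
    ... | same-head q      = exch-prefix q (principal π (i-with-neg-r n D))
    ... | other-head W r q = exch-prefix r (with-neg-r n (commute π D (↭-keep-head [ _ ] q)))
    commute π (with-pos m D₁ D₂) p with headSplit p
    ... | same-head q      = exch-prefix q (principal π (i-with-pos m D₁ D₂))
    ... | other-head W r q = exch-prefix r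
      (with-pos m (commute π D₁ (↭-keep-head [ _ ] q)) (commute π D₂ (↭-keep-head [ _ ] q)))
    commute π (tensor-neg n D) p with headSplit p
    ... | same-head q      = exch-prefix q (principal π (i-tensor-neg n D))
    ... | other-head W r q =
      exch-prefix r (tensor-neg n (commute π D (↭-keep-head (_ ∷ _ ∷ []) q)))
    commute π (tensor-pos {Γa} {Γb} m D₁ D₂) p with headSplit p
    ... | same-head q      = exch-prefix q (principal π (i-tensor-pos m D₁ D₂))
    ... | other-head W r q with appendSplit Γa Γb q
    ...   | in-left Γa′ q₁ qW =
      exch-prefix (↭-trans (↭-prep _ qW) r)
        (exch (↭-prep _ (solve 3 (λ a θ b → (a ⊕ θ) ⊕ b ⊜ (a ⊕ b) ⊕ θ) ↭-refl Γa′ _ Γb))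
          (tensor-pos m (commute π D₁ (↭-keep-head [ _ ] q₁)) D₂))
    ...   | in-right Γb′ q₂ qW =
      exch-prefix (↭-trans (↭-prep _ qW) r)
        (exch (↭-prep _ (↭-sym (↭.++-assoc Γa Γb′ _)))
          (tensor-pos m D₁ (commute π D₂ (↭-keep-head [ _ ] q₂))))
    commute π (bang-pos m w D) p with headSplit p
    ... | same-head q      = exch-prefix q (principal π (i-bang-pos m w D))
    ... | other-head W r q with wA ∷ wW ← ↭.All-resp-↭ q w =
      exch-prefix r
        (bang-pos m (All.++⁺ wW (partner-whyNot wA π)) (commute π D (↭-keep-head [ _ ] q)))
    commute π (bang-weaken n D) p with headSplit p
    ... | same-head q      = exch-prefix q (principal π (i-bang-neg n (bang-weaken n D)))
    ... | other-head W r q = exch-prefix r (bang-weaken n (commute π D q))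
    commute π (bang-derelict n D) p with headSplit p
    ... | same-head q      = exch-prefix q (principal π (i-bang-neg n (bang-derelict n D)))
    ... | other-head W r q = exch-prefix r (bang-derelict n (commute π D (↭-keep-head [ _ ] q)))
    commute π (bang-contract n D) p with headSplit p
    ... | same-head q      = exch-prefix q (principal π (i-bang-neg n (bang-contract n D)))
    ... | other-head W r q =
      exch-prefix r (bang-contract n (commute π D (↭-keep-head (_ ∷ _ ∷ []) q)))
    commute π (all-neg n t D) p with headSplit p
    ... | same-head q      = exch-prefix q (principal π (i-all-neg n t D))
    ... | other-head W r q = exch-prefix r (all-neg n t (commute π D (↭-keep-head [ _ ] q)))
    commute {Γ′ = Γ′} π (all-pos m D) p with headSplit p
    ... | same-head q      = exch-prefix q (principal π (i-all-pos m D))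
    ... | other-head W r q =
      exch-prefix r (all-pos m (map-shiftI-++ W (S ▹ _ ∷ Γ′)
        (commute (partner-shift π) D (↭-keep-head [ _ ] (↭.map⁺ shI q)))))

  module _ {R₁ R₂ S : RoleSet Ω} (c : Cover R₁ R₂) (S≐ : S ≐ R₁ ∩ R₂) where

    private
      mem-S : ∀ U → mem U R₁ → mem U R₂ → mem U S
      mem-S = mem-≐∩ S≐

      ¬mem-S₁ : ∀ U → ¬ mem U R₁ → ¬ mem U S
      ¬mem-S₁ U = ¬mem-⊆ U (≐∩-⊆ˡ S≐)

      ¬mem-S₂ : ∀ U → ¬ mem U R₂ → ¬ mem U S
      ¬mem-S₂ U = ¬mem-⊆ U (≐∩-⊆ʳ S≐)

    principal-atom : ∀ {P ts Γ₁ Γ₂} → Intro R₁ (atom P ts) Γ₁ → Intro R₂ (atom P ts) Γ₂ →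
                     Der (S ▹ atom P ts ∷ Γ₁ ++ Γ₂)
    principal-atom {P} {ts} (i-ax {L = L} part₁) (i-ax {L = M} part₂) =
      subst (λ Γ → Der (_ ∷ Γ)) (map-++ _ L M)
        (ax (S ∷ L ++ M) P ts (partition-merge S≐ c part₁ part₂))

    principal-neg : ∀ {f A Γ₁ Γ₂} → CutAt (shape A) →
                    Intro R₁ (neg f A) Γ₁ → Intro R₂ (neg f A) Γ₂ → Der (S ▹ neg f A ∷ Γ₁ ++ Γ₂)
    principal-neg {f} cutA (i-neg D₁) (i-neg D₂) =
      negR (cutA refl (λ r → c (f r)) (≐∩-preimage S≐ f) D₁ D₂)

    principal-with : ∀ {U A B Γ₁ Γ₂} → CutAt (shape A) → CutAt (shape B) →
                     Intro R₁ (with′ U A B) Γ₁ → Intro R₂ (with′ U A B) Γ₂ →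
                     Der (S ▹ with′ U A B ∷ Γ₁ ++ Γ₂)
    principal-with {U} cutA cutB (i-with-pos m₁ D₁ E₁) (i-with-pos m₂ D₂ E₂) =
      with-pos (mem-S U m₁ m₂) (cutA refl c S≐ D₁ D₂) (cutB refl c S≐ E₁ E₂)
    principal-with {U} cutA cutB (i-with-pos _ D₁ _) (i-with-neg-l n₂ D₂) =
      with-neg-l (¬mem-S₂ U n₂) (cutA refl c S≐ D₁ D₂)
    principal-with {U} cutA cutB (i-with-pos _ _ E₁) (i-with-neg-r n₂ E₂) =
      with-neg-r (¬mem-S₂ U n₂) (cutB refl c S≐ E₁ E₂)
    principal-with {U} cutA cutB (i-with-neg-l n₁ D₁) (i-with-pos _ D₂ _) =
      with-neg-l (¬mem-S₁ U n₁) (cutA refl c S≐ D₁ D₂)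
    principal-with {U} cutA cutB (i-with-neg-r n₁ E₁) (i-with-pos _ _ E₂) =
      with-neg-r (¬mem-S₁ U n₁) (cutB refl c S≐ E₁ E₂)
    principal-with {U} _ _ (i-with-neg-l n₁ _) (i-with-neg-l n₂ _) = ⊥-elim (cover-¬mem c U n₁ n₂)
    principal-with {U} _ _ (i-with-neg-l n₁ _) (i-with-neg-r n₂ _) = ⊥-elim (cover-¬mem c U n₁ n₂)
    principal-with {U} _ _ (i-with-neg-r n₁ _) (i-with-neg-l n₂ _) = ⊥-elim (cover-¬mem c U n₁ n₂)
    principal-with {U} _ _ (i-with-neg-r n₁ _) (i-with-neg-r n₂ _) = ⊥-elim (cover-¬mem c U n₁ n₂)

    principal-tensor : ∀ {U A B Γ₁ Γ₂} → CutAt (shape A) → CutAt (shape B) →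
                       Intro R₁ (tensor U A B) Γ₁ → Intro R₂ (tensor U A B) Γ₂ →
                       Der (S ▹ tensor U A B ∷ Γ₁ ++ Γ₂)
    principal-tensor {U} cutA cutB (i-tensor-pos {Γ₁ = Γa} {Γb} m₁ D₁ E₁)
                                   (i-tensor-pos {Γ₁ = Γc} {Γd} m₂ D₂ E₂) =
      exch (↭-prep _ (solve 4 (λ a b c d → (a ⊕ c) ⊕ (b ⊕ d) ⊜ (a ⊕ b) ⊕ (c ⊕ d))
                        ↭-refl Γa Γb Γc Γd))
        (tensor-pos (mem-S U m₁ m₂) (cutA refl c S≐ D₁ D₂) (cutB refl c S≐ E₁ E₂))
    principal-tensor {U} {A} {B} {Γ₂ = Γ₂} cutA cutB (i-tensor-pos {Γ₁ = Γa} {Γb} _ D₁ E₁)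
                                                     (i-tensor-neg n₂ D₂) =
      tensor-neg (¬mem-S₂ U n₂)
        (exch regroup (cutB refl c S≐ E₁ (exch B-first (cutA refl c S≐ D₁ D₂))))
      where
      B-first : S ▹ A ∷ Γa ++ R₂ ▹ B ∷ Γ₂ ↭ R₂ ▹ B ∷ S ▹ A ∷ Γa ++ Γ₂
      B-first = ↭-trans (↭-prep _ (↭.shift _ Γa Γ₂)) (↭-swap _ _ ↭-refl)
      regroup : S ▹ B ∷ Γb ++ S ▹ A ∷ Γa ++ Γ₂ ↭ S ▹ A ∷ S ▹ B ∷ (Γa ++ Γb) ++ Γ₂
      regroup = solve 5 (λ x y a b g → y ⊕ (b ⊕ (x ⊕ (a ⊕ g))) ⊜ x ⊕ (y ⊕ ((a ⊕ b) ⊕ g)))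
                  ↭-refl [ S ▹ A ] [ S ▹ B ] Γa Γb Γ₂
    principal-tensor {U} {Γ₁ = Γ₁} cutA cutB (i-tensor-neg n₁ D₁)
                                             (i-tensor-pos {Γ₁ = Γc} {Γd} _ D₂ E₂) =
      tensor-neg (¬mem-S₁ U n₁)
        (exch (↭-swap _ _ (↭.++-assoc Γ₁ Γc Γd))
          (cutB refl c S≐ (exch (↭-swap _ _ ↭-refl) (cutA refl c S≐ D₁ D₂)) E₂))
    principal-tensor {U} _ _ (i-tensor-neg n₁ _) (i-tensor-neg n₂ _) = ⊥-elim (cover-¬mem c U n₁ n₂)

    principal-bang : ∀ {U A Γ₁ Γ₂} → CutAt (shape A) →
                     Intro R₁ (bang U A) Γ₁ → Intro R₂ (bang U A) Γ₂ →
                     Der (S ▹ bang U A ∷ Γ₁ ++ Γ₂)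
    principal-bang {U} cutA (i-bang-pos m₁ w₁ D₁) (i-bang-pos m₂ w₂ D₂) =
      bang-pos (mem-S U m₁ m₂) (All.++⁺ w₁ w₂) (cutA refl c S≐ D₁ D₂)
    principal-bang {Γ₁ = Γ₁} {Γ₂} cutA (i-bang-pos _ w₁ D₁) (i-bang-neg n₂ D₂) =
      exch (↭.++-comm Γ₂ (_ ∷ Γ₁))
        (multicut-bang cutA c S≐ n₂ (refl , w₁ , D₁) D₂ (refl ∷ []) ↭-refl)
    principal-bang {Γ₁ = Γ₁} cutA (i-bang-neg n₁ D₁) (i-bang-pos _ w₂ D₂) =
      exch (↭.shift _ Γ₁ _)
        (multicut-bang cutA (cover-sym c) (≐∩-comm S≐) n₁ (refl , w₂ , D₂) D₁ (refl ∷ []) ↭-refl)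
    principal-bang {U} _ (i-bang-neg n₁ _) (i-bang-neg n₂ _) = ⊥-elim (cover-¬mem c U n₁ n₂)

    principal-all : ∀ {U A Γ₁ Γ₂} → CutAt (shape A) →
                    Intro R₁ (all U A) Γ₁ → Intro R₂ (all U A) Γ₂ →
                    Der (S ▹ all U A ∷ Γ₁ ++ Γ₂)
    principal-all {U} {Γ₁ = Γ₁} {Γ₂} cutA (i-all-pos m₁ D₁) (i-all-pos m₂ D₂) =
      all-pos (mem-S U m₁ m₂) (map-shiftI-++ Γ₁ Γ₂ (cutA refl c S≐ D₁ D₂))
    principal-all {U} {A} cutA (i-all-pos _ D₁) (i-all-neg n₂ t D₂) =
      all-neg (¬mem-S₂ U n₂) t (cutA (shape-subF (single Sg t) A) c S≐ (derivable-inst t D₁) D₂)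
    principal-all {U} {A} cutA (i-all-neg n₁ t D₁) (i-all-pos _ D₂) =
      all-neg (¬mem-S₁ U n₁) t (cutA (shape-subF (single Sg t) A) c S≐ D₁ (derivable-inst t D₂))
    principal-all {U} _ (i-all-neg n₁ _ _) (i-all-neg n₂ _ _) = ⊥-elim (cover-¬mem c U n₁ n₂)

  principal : ∀ {s A R₁ R₂ S Γ₁ Γ₂} → Below s → shape A ≡ s → Cover R₁ R₂ →
              S ≐ R₁ ∩ R₂ → Intro R₁ A Γ₁ → Intro R₂ A Γ₂ → Der (S ▹ A ∷ Γ₁ ++ Γ₂)
  principal {A = atom P ts}    _             refl c S≐ = principal-atom c S≐
  principal {A = neg f A}      cutA          refl c S≐ = principal-neg c S≐ cutA
  principal {A = with′ U A B}  (cutA , cutB) refl c S≐ = principal-with c S≐ cutA cutB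
  principal {A = tensor U A B} (cutA , cutB) refl c S≐ = principal-tensor c S≐ cutA cutB
  principal {A = bang U A}     cutA          refl c S≐ = principal-bang c S≐ cutA
  principal {A = all U A}      cutA          refl c S≐ = principal-all c S≐ cutA

  module _ {s : Shape} (below : Below s) {R₁ R₂ S : RoleSet Ω}
           (c : Cover R₁ R₂) (S≐ : S ≐ R₁ ∩ R₂) where

    cut-intro : ∀ {A Γ₁ Γ₂ Δ} → shape A ≡ s → Intro R₁ A Γ₁ →
                Der Δ → Δ ↭ R₂ ▹ A ∷ Γ₂ → Der (Γ₂ ++ S ▹ A ∷ Γ₁)
    cut-intro eq I = Commute.commute Partner shift whyNot-context cut-principal (eq , I)
      where
      Partner : Formula Sg Ω → Seq → Set₁
      Partner A Γ₁ = shape A ≡ s × Intro R₁ A Γ₁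

      shift : ∀ {A Γ₁} → Partner A Γ₁ → Partner (renF Sg suc A) (map shI Γ₁)
      shift {A} (eq , I) = trans (shape-renF suc A) eq , intro-shift I

      whyNot-context : ∀ {A Γ₁} → WhyNot (R₂ ▹ A) → Partner A Γ₁ → All WhyNot (S ▹ A ∷ Γ₁)
      whyNot-context {bang U _} (whyNot n₂) (_ , i-bang-pos _ w₁ _) =
        whyNot (¬mem-⊆ U (≐∩-⊆ʳ S≐) n₂) ∷ w₁
      whyNot-context {bang U _} (whyNot n₂) (_ , i-bang-neg n₁ _) =
        ⊥-elim (cover-¬mem c U n₁ n₂)

      cut-principal : ∀ {A Γ₂ Γ₁} → Partner A Γ₁ → Intro R₂ A Γ₂ → Der (Γ₂ ++ S ▹ A ∷ Γ₁)
      cut-principal {Γ₂ = Γ₂} {Γ₁} (eq , I₁) I₂ =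
        exch (↭.++-comm (_ ∷ Γ₁) Γ₂) (principal below eq c S≐ I₁ I₂)

    cut-¬whyNot : ∀ {A Γ₁ Γ₂ Δ} → shape A ≡ s → ¬ WhyNot (R₁ ▹ A) →
                  Der Δ → Δ ↭ R₁ ▹ A ∷ Γ₁ → Der (R₂ ▹ A ∷ Γ₂) → Der (Γ₁ ++ S ▹ A ∷ Γ₂)
    cut-¬whyNot eq nb D₁ p D₂ =
      Commute.commute Partner shift whyNot-context cut-principal (eq , nb , D₂) D₁ p
      where
      Partner : Formula Sg Ω → Seq → Set₁
      Partner A Γ₂ = shape A ≡ s × ¬ WhyNot (R₁ ▹ A) × Der (R₂ ▹ A ∷ Γ₂)

      shift : ∀ {A Γ₂} → Partner A Γ₂ → Partner (renF Sg suc A) (map shI Γ₂)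
      shift {A} (eq , nb , D₂) =
        trans (shape-renF suc A) eq , nb ∘ whyNot-renF⁻ suc A , derivable-shift D₂

      whyNot-context : ∀ {A Γ₂} → WhyNot (R₁ ▹ A) → Partner A Γ₂ → All WhyNot (S ▹ A ∷ Γ₂)
      whyNot-context w (_ , nb , _) = ⊥-elim (nb w)

      cut-principal : ∀ {A Γ₁ Γ₂} → Partner A Γ₂ → Intro R₁ A Γ₁ → Der (Γ₁ ++ S ▹ A ∷ Γ₂)
      cut-principal {Γ₁ = Γ₁} {Γ₂} (eq , _ , D₂) I₁ =
        exch (↭-trans (↭.++-comm Γ₂ (_ ∷ Γ₁)) (↭-sym (↭.shift _ Γ₁ Γ₂)))
          (cut-intro eq I₁ D₂ ↭-refl)

  cut   : ∀ s → CutAt s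
  below : ∀ s → Below s

  cut s {A} eq {Γ₁ = Γ₁} {Γ₂} c S≐ D₁ D₂ with ¬whyNot-one-side c A
  ... | inj₁ nb₁ = exch (↭.shift _ Γ₁ Γ₂) (cut-¬whyNot (below s) c S≐ eq nb₁ D₁ ↭-refl D₂)
  ... | inj₂ nb₂ = exch (↭.++-comm Γ₂ (_ ∷ Γ₁))
                     (cut-¬whyNot (below s) (cover-sym c) (≐∩-comm S≐) eq nb₂ D₂ ↭-refl D₁)

  below atomS         = tt
  below (negS s)      = cut s
  below (bangS s)     = cut s
  below (allS s)      = cut s
  below (tensorS s t) = cut s , cut t
  below (withS s t)   = cut s , cut t

lemma12 : {Ω : Set} (Sg : Signature) (R₁ R₂ : RoleSet Ω) →
          (∀ (r : Ω) → ¬ (∁ R₁ r × ∁ R₂ r)) →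
          (Γ₁ Γ₂ : Sequent Sg Ω) (A : Formula Sg Ω) →
          Derivable Sg Ω (R₁ ▹ A ∷ Γ₁) →
          Derivable Sg Ω (R₂ ▹ A ∷ Γ₂) →
          Derivable Sg Ω ((R₁ ∩ R₂) ▹ A ∷ (Γ₁ ++ Γ₂))
lemma12 Sg R₁ R₂ cover Γ₁ Γ₂ A D₁ D₂ = cut (shape A) refl cover ≐-refl D₁ D₂
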